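{- Let $p>0$, $\gamma>0$, $n\ge 4p$, and let $\alpha$ satisfy $2p-1\le\alpha\le n-2p-1$ and $\gcd(\alpha,n)=1$. Let $I=\{0,\dots,p-1\}$, $J=\{0,\dots,p-2\}$, let $f_I:I\to I$ and $f_J:J\to J$ be any bijections, let $A'$ be the array defined below for $(f_I,f_J)$ and let $A$ be the array defined below when $f_I$ and $f_J$ are the identity maps. Then for every row $a$ and every column $a$, and for all $i\in I$ and $j\in J$, $\Sigma_{A'}(t)=\Sigma_A(t)$ and $\overline{\Sigma}_{A'}(t)=\overline{\Sigma}_A(t)$ for each $t\in\{2i+1,\ 2p+2j+2,\ 2p,\ 2p+\alpha\}$.
   Context: Rows and columns of an $n\times n$ array are indexed by $[n]=\{0,\dots,n-1\}$, with row and column indices always taken modulo $n$ (entries are integers, not reduced). The diagonal $D_d$ is $\{(i+d,i): i\in[n]\}$. Given bijections $f_I,f_J$, the array $A'$ is the $n\times n$ array in which, for all $i\in I$, $j\in J$, $x\in[n]$, the following entries are placed (all other cells empty): $(\gamma+2)n+4f_I(i)n-2x$ in cell $(2i-x,-x)\in D_{2i}$; $-\gamma n-4f_I(i)n-1-2x$ in cell $(2i+1+x,x)\in D_{2i+1}$; $-(4p+\gamma)n+2x$ in cell $(2p-\alpha x,-\alpha x)\in D_{2p}$; $(4p+\gamma-6)n-4f_J(j)n+1+2x$ in cell $(2p+1+2j-x,-x)\in D_{2p+1+2j}$; $-(4p+\gamma-4)n+4f_J(j)n+2x$ in cell $(2p+2+2j+x,x)\in D_{2p+2+2j}$; $(4p+\gamma-2)n+1+2x$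 in cell $(2p+\alpha+\alpha x,\alpha x)\in D_{2p+\alpha}$. For an array $X$ of this form and a row $a$, $d_t(r_a)$ is the entry of row $a$ on diagonal $D_t$ ($0$ if none), and $\Sigma_X(y)=\sum_{t=0}^{y}d_t(r_a)$; for a column $a$, $d_t(c_a)$ is the entry of column $a$ on $D_t$ ($0$ if none), and $\overline{\Sigma}_X(y)=\sum_{t=0}^{y}d_t(c_a)$. -}

module Defs where

open import Data.Nat as ℕ using (ℕ)
open import Data.Nat.Divisibility using (_∣?_)
open import Data.Integer as ℤ using (ℤ; +_; _+_; _-_; _*_; -_; ∣_∣)
open import Data.Fin using (Fin; toℕ)
open import Data.Fin.Permutation using (Permutation′; _⟨$⟩ʳ_)
open import Data.List using (List; []; _∷_; map; concatMap; upTo; allFin; foldr; _++_)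
open import Data.Product using (_×_; _,_)
open import Data.Bool using (Bool; if_then_else_; _∧_)
open import Relation.Nullary.Decidable using (⌊_⌋)

-- A placement: (entry value , row index , column index); indices are integers
-- read modulo n.
Placement : Set
Placement = ℤ × ℤ × ℤ

≡mod : ℕ → ℤ → ℤ → Bool
≡mod n r s = ⌊ n ∣? ∣ r - s ∣ ⌋

sumℤ : List ℤ → ℤ
sumℤ = foldr _+_ (+ 0)

-- The array A' for parameters p γ n α and bijections fI : I → I, fJ : J → J,
-- where I = {0,…,p-1} = Fin p and J = {0,…,p-2} = Fin (p ∸ 1).
arrayA' : (p γ n α : ℕ) → Permutation′ p → Permutation′ (p ℕ.∸ 1) → List Placement
arrayA' p γ n α fI fJ =
  concatMap (λ i → concatMap (λ x → rule1 i x ∷ rule2 i x ∷ []) xs) (allFin p)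
  ++ map rule3 xs
  ++ concatMap (λ j → concatMap (λ x → rule4 j x ∷ rule5 j x ∷ []) xs) (allFin (p ℕ.∸ 1))
  ++ map rule6 xs
  where
  xs : List ℕ
  xs = upTo n
  N P G A : ℤ
  N = + n
  P = + p
  G = + γ
  A = + α
  FI : Fin p → ℤ
  FI i = + toℕ (fI ⟨$⟩ʳ i)
  FJ : Fin (p ℕ.∸ 1) → ℤ
  FJ j = + toℕ (fJ ⟨$⟩ʳ j)
  rule1 : Fin p → ℕ → Placement
  rule1 i x = ((G + + 2) * N + + 4 * FI i * N - + 2 * + x)
            , (+ 2 * + toℕ i - + x) , (- + x)
  rule2 : Fin p → ℕ → Placement
  rule2 i x = (- (G * N) - + 4 * FI i * N - + 1 - + 2 * + x)
            , (+ 2 * + toℕ i + + 1 + + x) , + x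
  rule3 : ℕ → Placement
  rule3 x = (- ((+ 4 * P + G) * N) + + 2 * + x)
          , (+ 2 * P - A * + x) , (- (A * + x))
  rule4 : Fin (p ℕ.∸ 1) → ℕ → Placement
  rule4 j x = ((+ 4 * P + G - + 6) * N - + 4 * FJ j * N + + 1 + + 2 * + x)
            , (+ 2 * P + + 1 + + 2 * + toℕ j - + x) , (- + x)
  rule5 : Fin (p ℕ.∸ 1) → ℕ → Placement
  rule5 j x = (- ((+ 4 * P + G - + 4) * N) + + 4 * FJ j * N + + 2 * + x)
            , (+ 2 * P + + 2 + + 2 * + toℕ j + + x) , + x
  rule6 : ℕ → Placement
  rule6 x = ((+ 4 * P + G - + 2) * N + + 1 + + 2 * + x)
          , (+ 2 * P + A + A * + x) , (A * + x)

arrayA : (p γ n α : ℕ) → List Placement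
arrayA p γ n α = arrayA' p γ n α Data.Fin.Permutation.id Data.Fin.Permutation.id

-- entry of cell (r , c) (indices mod n); 0 if the cell is empty
-- (sum of all values placed in that cell; in a well-defined array at most one)
cellEntry : ℕ → List Placement → ℤ → ℤ → ℤ
cellEntry n X r c =
  sumℤ (map (λ { (v , r' , c') → if ≡mod n r' r ∧ ≡mod n c' c then v else + 0 }) X)

-- d_t(r_a): entry of row a on diagonal D_t = {(i+t, i)}, i.e. cell (a, a - t)
dRow : ℕ → List Placement → ℕ → ℕ → ℤ
dRow n X a t = cellEntry n X (+ a) (+ a - + t)

-- d_t(c_a): entry of column a on diagonal D_t, i.e. cell (a + t, a)
dCol : ℕ → List Placement → ℕ → ℕ → ℤ
dCol n X a t = cellEntry n X (+ a + + t) (+ a)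

ΣRow : ℕ → List Placement → ℕ → ℕ → ℤ
ΣRow n X a y = sumℤ (map (dRow n X a) (upTo (ℕ.suc y)))

ΣCol : ℕ → List Placement → ℕ → ℕ → ℤ
ΣCol n X a y = sumℤ (map (dCol n X a) (upTo (ℕ.suc y)))

-- A' differs from A only through the labels f_I(i), f_J(j): in block i a label u adds 4un to
-- every entry on D_2i and subtracts 4un from every entry on D_2i+1; in block j it subtracts
-- 4un on D_2p+1+2j and adds it on D_2p+2+2j.  A prefix sum Σ(t) of a row or column is linear
-- in the placed values: it weights each value by how often its cell is met by the window of
-- cells d_0,…,d_t.  A full diagonal meets a row (column) exactly once, so diagonal D carries
-- total weight 1 if D ≤ t and 0 otherwise, and two adjacent diagonals D, D+1 carry the same
-- weight unless t = D.  None of the steps t of the theorem equals 2i or 2p+1+2j, so every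
-- label shift cancels.

module Submission where

open import Defs
open import Data.Nat using (ℕ; _+_; _*_; _≤_; _<_; _∸_)
open import Data.Nat.GCD using (gcd)
open import Data.Fin using (Fin; toℕ)
open import Data.Fin.Permutation using (Permutation′)
open import Data.Product using (_×_)
open import Data.Sum using (_⊎_)
open import Relation.Binary.PropositionalEquality using (_≡_)

open import Data.Nat using (suc; zero; NonZero; >-nonZero; _≟_; _<?_; z≤n; s≤s)
import Data.Nat.Properties as ℕP
open import Data.Nat.Divisibility using (_∣?_; >⇒∤; _∣0) renaming (_∣_ to _∣ℕ_)
open import Data.Nat.Tactic.RingSolver using () renaming (solve-∀ to solveℕ-∀)
open import Data.Integer as Z using (ℤ; +_; ∣_∣)
import Data.Integer.Properties as ZP
open import Data.Integer.Divisibility.Signed using (_∣_; ∣ᵤ⇒∣; ∣⇒∣ᵤ; ∣m∣n⇒∣m+n; ∣m∣n⇒∣m-n; ∣m⇒∣-m; ∣n⇒∣m*n; ∣-refl)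
open import Data.Integer.DivMod using (_%ℕ_; _/ℕ_; a≡a%ℕn+[a/ℕn]*n; n%ℕd<d)
open import Data.Integer.Tactic.RingSolver using (solve-∀)
import Data.Fin.Properties as FinP
open import Data.Fin.Permutation using (_⟨$⟩ʳ_)
import Data.Fin.Permutation as Perm
open import Data.Bool using (Bool; true; false; if_then_else_; _∧_)
open import Data.Bool.Properties using (∧-zeroʳ; ∧-identityʳ)
open import Data.List using (List; []; _∷_; map; concatMap; upTo; allFin; _++_)
import Data.List.Properties as ListP
open import Data.Product using (_,_)
open import Data.Sum using (inj₁; inj₂)
open import Data.Empty using (⊥-elim)
open import Function using (_∘_)
open import Relation.Nullary using (Dec; yes; no; ¬_)
open import Relation.Nullary.Decidable using (⌊_⌋)
open import Relation.Binary.Definitions using (tri<; tri≈; tri>)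
open import Relation.Binary.PropositionalEquality using (_≢_; refl; sym; trans; cong; cong₂; subst; module ≡-Reasoning)

sumOf : {A : Set} → (A → ℤ) → List A → ℤ
sumOf f L = sumℤ (map f L)

module _ {A : Set} where

  sumOf-cong : {f g : A → ℤ} (L : List A) → (∀ x → f x ≡ g x) → sumOf f L ≡ sumOf g L
  sumOf-cong L f≗g = cong sumℤ (ListP.map-cong f≗g L)

  sumOf-zero : (L : List A) → sumOf (λ _ → + 0) L ≡ + 0
  sumOf-zero [] = refl
  sumOf-zero (_ ∷ L) = trans (ZP.+-identityˡ _) (sumOf-zero L)

  sumOf-++ : (f : A → ℤ) (L M : List A) → sumOf f (L ++ M) ≡ sumOf f L Z.+ sumOf f M
  sumOf-++ f [] M = sym (ZP.+-identityˡ _)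
  sumOf-++ f (x ∷ L) M = trans (cong (Z._+_ (f x)) (sumOf-++ f L M)) (sym (ZP.+-assoc (f x) _ _))

  sumOf-+ : (f g : A → ℤ) (L : List A) → sumOf (λ x → f x Z.+ g x) L ≡ sumOf f L Z.+ sumOf g L
  sumOf-+ f g [] = refl
  sumOf-+ f g (x ∷ L) = trans (cong (Z._+_ (f x Z.+ g x)) (sumOf-+ f g L)) (interchange (f x) (g x) _ _)
    where
    interchange : ∀ a b c d → (a Z.+ b) Z.+ (c Z.+ d) ≡ (a Z.+ c) Z.+ (b Z.+ d)
    interchange = solve-∀

  sumOf-*ˡ : (d : ℤ) (f : A → ℤ) (L : List A) → sumOf (λ x → d Z.* f x) L ≡ d Z.* sumOf f L
  sumOf-*ˡ d f [] = sym (ZP.*-zeroʳ d)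
  sumOf-*ˡ d f (x ∷ L) = trans (cong (Z._+_ (d Z.* f x)) (sumOf-*ˡ d f L)) (sym (ZP.*-distribˡ-+ d (f x) _))

  sumOf-*ʳ : (d : ℤ) (f : A → ℤ) (L : List A) → sumOf (λ x → f x Z.* d) L ≡ sumOf f L Z.* d
  sumOf-*ʳ d f L = trans (sumOf-cong L (λ x → ZP.*-comm (f x) d))
                         (trans (sumOf-*ˡ d f L) (ZP.*-comm d _))

  sumOf-concatMap : {B : Set} (f : A → ℤ) (g : B → List A) (L : List B) →
    sumOf f (concatMap g L) ≡ sumOf (λ y → sumOf f (g y)) L
  sumOf-concatMap f g [] = refl
  sumOf-concatMap f g (y ∷ L) = trans (sumOf-++ f (g y) (concatMap g L)) (cong (Z._+_ (sumOf f (g y))) (sumOf-concatMap f g L))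

sumOf-swap : {A B : Set} (f : B → A → ℤ) (T : List B) (L : List A) →
  sumOf (λ t → sumOf (f t) L) T ≡ sumOf (λ x → sumOf (λ t → f t x) T) L
sumOf-swap f T [] = sumOf-zero T
sumOf-swap f T (x ∷ L) =
  trans (sumOf-+ (λ t → f t x) (λ t → sumOf (f t) L) T) (cong (Z._+_ (sumOf (λ t → f t x) T)) (sumOf-swap f T L))

sumOf-upTo-suc : (f : ℕ → ℤ) (T : ℕ) → sumOf f (upTo (suc T)) ≡ sumOf f (upTo T) Z.+ f T
sumOf-upTo-suc f T = begin
  sumOf f (upTo (suc T))             ≡⟨ cong (sumOf f) (sym (ListP.upTo-∷ʳ T)) ⟩
  sumOf f (upTo T ++ T ∷ [])         ≡⟨ sumOf-++ f (upTo T) (T ∷ []) ⟩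
  sumOf f (upTo T) Z.+ (f T Z.+ + 0) ≡⟨ cong (Z._+_ (sumOf f (upTo T))) (ZP.+-identityʳ (f T)) ⟩
  sumOf f (upTo T) Z.+ f T           ∎
  where open ≡-Reasoning

𝟙 : Bool → ℤ
𝟙 b = if b then + 1 else + 0

if-as-product : ∀ b (v : ℤ) → (if b then v else + 0) ≡ v Z.* 𝟙 b
if-as-product true v = sym (ZP.*-identityʳ v)
if-as-product false v = sym (ZP.*-zeroʳ v)

𝟙-∧ : ∀ b c → 𝟙 (b ∧ c) ≡ 𝟙 b Z.* 𝟙 c
𝟙-∧ true c = sym (ZP.*-identityˡ (𝟙 c))
𝟙-∧ false c = refl

𝟙? : {A : Set} → Dec A → ℤ
𝟙? (yes _) = + 1
𝟙? (no _) = + 0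

𝟙?-yes : {A : Set} (d : Dec A) → A → 𝟙? d ≡ + 1
𝟙?-yes (yes _) _ = refl
𝟙?-yes (no ¬a) a = ⊥-elim (¬a a)

𝟙?-no : {A : Set} (d : Dec A) → ¬ A → 𝟙? d ≡ + 0
𝟙?-no (yes a) ¬a = ⊥-elim (¬a a)
𝟙?-no (no _) _ = refl

<?-suc : ∀ {D T} → D ≢ T → 𝟙? (D <? suc T) ≡ 𝟙? (D <? T)
<?-suc {D} {T} D≢T with ℕP.<-cmp D T
... | tri< D<T _ _ = trans (𝟙?-yes (D <? suc T) (ℕP.m<n⇒m<1+n D<T)) (sym (𝟙?-yes (D <? T) D<T))
... | tri≈ _ D≡T _ = ⊥-elim (D≢T D≡T)
... | tri> _ _ T<D = trans (𝟙?-no (D <? suc T) (ℕP.<⇒≱ T<D ∘ ℕP.m<1+n⇒m≤n))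
                           (sym (𝟙?-no (D <? T) (ℕP.<-asym T<D)))

<?-suc-suc : ∀ D T → 𝟙? (suc D <? suc T) ≡ 𝟙? (D <? T)
<?-suc-suc D T with D <? T
... | yes D<T = 𝟙?-yes (suc D <? suc T) (s≤s D<T)
... | no D≮T = 𝟙?-no (suc D <? suc T) (D≮T ∘ ℕP.<-pred)

adjacent-diagonals : ∀ {D t} → D ≢ t → 𝟙? (D <? suc t) ≡ 𝟙? (suc D <? suc t)
adjacent-diagonals {D} {t} D≢t = trans (<?-suc D≢t) (sym (<?-suc-suc D t))

-- g : ℕ → ℤ runs through consecutive integers, upwards or downwards, as x runs through ℕ.
-- Each row and column coordinate along a diagonal of the array is of this form.
data Sweeps (g : ℕ → ℤ) : Set where
  ascending  : (u : ℤ) → (∀ x → g x ≡ u Z.+ + x) → Sweeps g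
  descending : (u : ℤ) → (∀ x → g x ≡ u Z.- + x) → Sweeps g

module Congruence (n : ℕ) where

  ≡mod-diff : ∀ r s r′ s′ → r Z.- s ≡ r′ Z.- s′ → ≡mod n r s ≡ ≡mod n r′ s′
  ≡mod-diff _ _ _ _ eq = cong (λ e → ⌊ n ∣? ∣ e ∣ ⌋) eq

  ≡mod-true⇒∣ : ∀ r s → ≡mod n r s ≡ true → + n ∣ (r Z.- s)
  ≡mod-true⇒∣ r s holds with n ∣? ∣ r Z.- s ∣
  ≡mod-true⇒∣ r s refl | yes n∣ = ∣ᵤ⇒∣ n∣

  ≡mod-transfer : ∀ r s r′ s′ {k} → + n ∣ k → r Z.- s ≡ (r′ Z.- s′) Z.+ k → ≡mod n r s ≡ ≡mod n r′ s′
  ≡mod-transfer r s r′ s′ {k} n∣k eq with n ∣? ∣ r Z.- s ∣ | n ∣? ∣ r′ Z.- s′ ∣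
  ... | yes _ | yes _ = refl
  ... | no _ | no _ = refl
  ... | yes n∣e | no n∤e′ = ⊥-elim (n∤e′ (∣⇒∣ᵤ (subst (+ n ∣_) back (∣m∣n⇒∣m-n (∣ᵤ⇒∣ {i = r Z.- s} n∣e) n∣k))))
    where
    cancel : ∀ e k → (e Z.+ k) Z.- k ≡ e
    cancel = solve-∀
    back : (r Z.- s) Z.- k ≡ r′ Z.- s′
    back = trans (cong (Z._- k) eq) (cancel (r′ Z.- s′) k)
  ... | no n∤e | yes n∣e′ = ⊥-elim (n∤e (∣⇒∣ᵤ (subst (+ n ∣_) (sym eq) (∣m∣n⇒∣m+n (∣ᵤ⇒∣ {i = r′ Z.- s′} n∣e′) n∣k))))

  ≡mod-sym : ∀ r s → ≡mod n r s ≡ ≡mod n s r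
  ≡mod-sym r s = cong (λ e → ⌊ n ∣? e ⌋) (trans (cong ∣_∣ (flip r s)) (ZP.∣-i∣≡∣i∣ (s Z.- r)))
    where
    flip : ∀ r s → r Z.- s ≡ Z.- (s Z.- r)
    flip = solve-∀

  ≡mod-refl : ∀ r → ≡mod n r r ≡ true
  ≡mod-refl r rewrite ZP.+-inverseʳ r with n ∣? 0
  ... | yes _ = refl
  ... | no n∤0 = ⊥-elim (n∤0 (n ∣0))

  ≡mod-distinct : ∀ {x y} → x < n → y < n → x ≢ y → ≡mod n (+ x) (+ y) ≡ false
  ≡mod-distinct {x} {y} x<n y<n x≢y with n ∣? ∣ + x Z.- + y ∣
  ... | no _ = refl
  ... | yes n∣ = ⊥-elim (x≢y (ZP.+-injective (ZP.i-j≡0⇒i≡j (+ x) (+ y) (ZP.∣i∣≡0⇒i≡0 (small _ bound n∣)))))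
    where
    bound : ∣ + x Z.- + y ∣ < n
    bound rewrite ZP.[+m]-[+n]≡m⊖n x y = ℕP.≤-<-trans (ZP.∣m⊝n∣≤m⊔n x y) (ℕP.⊔-lub x<n y<n)
    small : ∀ d → d < n → n ∣ℕ d → d ≡ 0
    small zero _ _ = refl
    small (suc d) d<n n∣d = ⊥-elim (>⇒∤ d<n n∣d)

  window-count : ∀ {D} T → D < n → T ≤ n → sumOf (λ t → 𝟙 (≡mod n (+ D) (+ t))) (upTo T) ≡ 𝟙? (D <? T)
  window-count {D} zero D<n _ = sym (𝟙?-no (D <? 0) λ ())
  window-count {D} (suc T) D<n T<n = begin
    sumOf f (upTo (suc T))             ≡⟨ sumOf-upTo-suc f T ⟩
    sumOf f (upTo T) Z.+ f T           ≡⟨ cong (Z._+ f T) (window-count T D<n (ℕP.<⇒≤ T<n)) ⟩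
    𝟙? (D <? T) Z.+ f T                ≡⟨ step ⟩
    𝟙? (D <? suc T)                    ∎
    where
    open ≡-Reasoning
    f : ℕ → ℤ
    f t = 𝟙 (≡mod n (+ D) (+ t))
    step : 𝟙? (D <? T) Z.+ f T ≡ 𝟙? (D <? suc T)
    step with D ≟ T
    ... | yes refl rewrite ≡mod-refl (+ D) | 𝟙?-no (D <? D) (ℕP.<-irrefl refl)
                         | 𝟙?-yes (D <? suc D) (ℕP.n<1+n D) = refl
    ... | no D≢T rewrite ≡mod-distinct D<n T<n D≢T | <?-suc D≢T = ZP.+-identityʳ _

  module _ .{{_ : NonZero n}} where

    residue-count : ∀ z → sumOf (λ x → 𝟙 (≡mod n (+ x) z)) (upTo n) ≡ + 1
    residue-count z = begin
      sumOf (λ x → 𝟙 (≡mod n (+ x) z)) (upTo n)   ≡⟨ sumOf-cong (upTo n) (λ x → cong 𝟙 (to-residue x)) ⟩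
      sumOf (λ x → 𝟙 (≡mod n (+ ρ) (+ x))) (upTo n) ≡⟨ window-count n ρ<n ℕP.≤-refl ⟩
      𝟙? (ρ <? n)                                   ≡⟨ 𝟙?-yes (ρ <? n) ρ<n ⟩
      + 1                                           ∎
      where
      open ≡-Reasoning
      ρ : ℕ
      ρ = z %ℕ n
      ρ<n : ρ < n
      ρ<n = n%ℕd<d z n
      q : ℤ
      q = z /ℕ n
      split : ∀ x → + x Z.- z ≡ (+ x Z.- + ρ) Z.+ Z.- (q Z.* + n)
      split x = trans (cong (Z._-_ (+ x)) (a≡a%ℕn+[a/ℕn]*n z n)) (regroup (+ x) (+ ρ) q (+ n))
        where
        regroup : ∀ x ρ q n → x Z.- (ρ Z.+ q Z.* n) ≡ (x Z.- ρ) Z.+ Z.- (q Z.* n)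
        regroup = solve-∀
      to-residue : ∀ x → ≡mod n (+ x) z ≡ ≡mod n (+ ρ) (+ x)
      to-residue x = trans (≡mod-transfer (+ x) z (+ x) (+ ρ) (∣m⇒∣-m (∣n⇒∣m*n q ∣-refl)) (split x)) (≡mod-sym (+ x) (+ ρ))

    sweep-count : ∀ {g} → Sweeps g → ∀ w → sumOf (λ x → 𝟙 (≡mod n (g x) w)) (upTo n) ≡ + 1
    sweep-count {g} (ascending u g≡) w = trans (sumOf-cong (upTo n) (cong 𝟙 ∘ to-residue)) (residue-count (w Z.- u))
      where
      shift : ∀ u x w → (u Z.+ x) Z.- w ≡ x Z.- (w Z.- u)
      shift = solve-∀
      to-residue : ∀ x → ≡mod n (g x) w ≡ ≡mod n (+ x) (w Z.- u)
      to-residue x = ≡mod-diff (g x) w (+ x) (w Z.- u) (trans (cong (Z._- w) (g≡ x)) (shift u (+ x) w))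
    sweep-count {g} (descending u g≡) w = trans (sumOf-cong (upTo n) (cong 𝟙 ∘ to-residue)) (residue-count (u Z.- w))
      where
      shift : ∀ u x w → (u Z.- x) Z.- w ≡ (u Z.- w) Z.- x
      shift = solve-∀
      to-residue : ∀ x → ≡mod n (g x) w ≡ ≡mod n (+ x) (u Z.- w)
      to-residue x = trans (≡mod-diff (g x) w (u Z.- w) (+ x) (trans (cong (Z._- w) (g≡ x)) (shift u (+ x) w)))
                           (≡mod-sym (u Z.- w) (+ x))

entryAt : ℕ → ℤ → ℤ → Placement → ℤ
entryAt n r c (v , r′ , c′) = if ≡mod n r′ r ∧ ≡mod n c′ c then v else + 0

weight : (ℤ → ℤ → ℤ) → Placement → ℤ
weight h (v , r , c) = v Z.* h r c

weightedSum : (ℤ → ℤ → ℤ) → List Placement → ℤ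
weightedSum h = sumOf (weight h)

-- The window (rf t′ , cf t′)_t′ runs along one line key ≡ a (a row or a column), meeting
-- diagonal D at step D: a cell (r , c) on diagonal D is met at step t′ iff key r c ≡ a and D ≡ t′.
DiagonalShape : ℕ → (rf cf : ℕ → ℤ) → (ℤ → ℤ → ℤ) → ℤ → Set
DiagonalShape n rf cf key a = ∀ r c D t′ → r Z.- c ≡ + D →
  (≡mod n r (rf t′) ∧ ≡mod n c (cf t′)) ≡ (≡mod n (key r c) a ∧ ≡mod n (+ D) (+ t′))

-- The key coordinate runs through consecutive integers along both kinds of diagonals of the
-- array: x ↦ (u - x , - x) and x ↦ (u + x , x).
KeySweeps : (ℤ → ℤ → ℤ) → Set
KeySweeps key = (∀ u → Sweeps (λ x → key (u Z.- + x) (Z.- + x))) × (∀ u → Sweeps (λ x → key (u Z.+ + x) (+ x)))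

-- A window is a run of cells (rf t′ , cf t′), t′ = 0,…,t.  The prefix sums ΣRow and ΣCol
-- are the sums Φ of the entries of an array over such windows.
module Window (n t : ℕ) (rf cf : ℕ → ℤ) where
  open Congruence n

  Φ : List Placement → ℤ
  Φ X = sumOf (λ t′ → cellEntry n X (rf t′) (cf t′)) (upTo (suc t))

  hits : ℤ → ℤ → ℤ
  hits r c = sumOf (λ t′ → 𝟙 (≡mod n r (rf t′) ∧ ≡mod n c (cf t′))) (upTo (suc t))

  -- Φ is linear: it weights every placed value by the hits of its cell.  (By definition
  -- cellEntry is the sum of entryAt over the placements; the two sums are then exchanged.)
  Φ-weighted : ∀ X → Φ X ≡ weightedSum hits X
  Φ-weighted X = begin
    Φ X                                                              ≡⟨⟩
    sumOf (λ t′ → sumOf (entryAt n (rf t′) (cf t′)) X) (upTo (suc t)) ≡⟨ sumOf-swap (λ t′ → entryAt n (rf t′) (cf t′)) (upTo (suc t)) X ⟩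
    sumOf (λ pl → sumOf (λ t′ → entryAt n (rf t′) (cf t′) pl) (upTo (suc t))) X ≡⟨ sumOf-cong X placement ⟩
    weightedSum hits X                                               ∎
    where
    open ≡-Reasoning
    placement : ∀ pl → sumOf (λ t′ → entryAt n (rf t′) (cf t′) pl) (upTo (suc t)) ≡ weight hits pl
    placement (v , r , c) =
      trans (sumOf-cong (upTo (suc t)) (λ t′ → if-as-product (≡mod n r (rf t′) ∧ ≡mod n c (cf t′)) v))
            (sumOf-*ˡ v _ (upTo (suc t)))

  module _ {key : ℤ → ℤ → ℤ} {a : ℤ} (shape : DiagonalShape n rf cf key a) (t<n : t < n) where

    hits-on-diagonal : ∀ {r c D} → D < n → r Z.- c ≡ + D →
      hits r c ≡ 𝟙 (≡mod n (key r c) a) Z.* 𝟙? (D <? suc t)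
    hits-on-diagonal {r} {c} {D} D<n onD = begin
      hits r c                                                          ≡⟨ sumOf-cong (upTo (suc t)) (λ t′ → cong 𝟙 (shape r c D t′ onD)) ⟩
      sumOf (λ t′ → 𝟙 (onLine ∧ ≡mod n (+ D) (+ t′))) (upTo (suc t))   ≡⟨ sumOf-cong (upTo (suc t)) (λ t′ → 𝟙-∧ onLine _) ⟩
      sumOf (λ t′ → 𝟙 onLine Z.* 𝟙 (≡mod n (+ D) (+ t′))) (upTo (suc t)) ≡⟨ sumOf-*ˡ (𝟙 onLine) _ (upTo (suc t)) ⟩
      𝟙 onLine Z.* sumOf (λ t′ → 𝟙 (≡mod n (+ D) (+ t′))) (upTo (suc t)) ≡⟨ cong (𝟙 onLine Z.*_) (window-count (suc t) D<n t<n) ⟩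
      𝟙 onLine Z.* 𝟙? (D <? suc t)                                      ∎
      where
      open ≡-Reasoning
      onLine : Bool
      onLine = ≡mod n (key r c) a

    -- A full diagonal x ↦ (rx x , cx x), x ∈ [0, n), whose key coordinate sweeps,
    -- crosses the line exactly once, so it is met once if D ≤ t and never otherwise.
    diagonal-hits : .{{_ : NonZero n}} → ∀ {D} (rx cx : ℕ → ℤ) → D < n → (∀ x → rx x Z.- cx x ≡ + D) →
      Sweeps (λ x → key (rx x) (cx x)) → sumOf (λ x → hits (rx x) (cx x)) (upTo n) ≡ 𝟙? (D <? suc t)
    diagonal-hits {D} rx cx D<n onD sweeps = begin
      sumOf (λ x → hits (rx x) (cx x)) (upTo n)                                     ≡⟨ sumOf-cong (upTo n) (λ x → hits-on-diagonal D<n (onD x)) ⟩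
      sumOf (λ x → 𝟙 (≡mod n (key (rx x) (cx x)) a) Z.* 𝟙? (D <? suc t)) (upTo n) ≡⟨ sumOf-*ʳ (𝟙? (D <? suc t)) _ (upTo n) ⟩
      sumOf (λ x → 𝟙 (≡mod n (key (rx x) (cx x)) a)) (upTo n) Z.* 𝟙? (D <? suc t)  ≡⟨ cong (Z._* 𝟙? (D <? suc t)) (sweep-count sweeps a) ⟩
      + 1 Z.* 𝟙? (D <? suc t)                                                       ≡⟨ ZP.*-identityˡ _ ⟩
      𝟙? (D <? suc t)                                                               ∎
      where open ≡-Reasoning

    adjacent-balanced : .{{_ : NonZero n}} → KeySweeps key → ∀ {D} (u₁ u₂ : ℤ) → suc D < n → D ≢ t →
      (∀ x → (u₁ Z.- + x) Z.- Z.- + x ≡ + D) → (∀ x → (u₂ Z.+ + x) Z.- + x ≡ + suc D) →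
      sumOf (λ x → hits (u₁ Z.- + x) (Z.- + x)) (upTo n) ≡ sumOf (λ x → hits (u₂ Z.+ + x) (+ x)) (upTo n)
    adjacent-balanced (down , up) u₁ u₂ D+1<n D≢t onD onD+1 = begin
      sumOf (λ x → hits (u₁ Z.- + x) (Z.- + x)) (upTo n) ≡⟨ diagonal-hits _ _ (ℕP.<-trans (ℕP.n<1+n _) D+1<n) onD (down u₁) ⟩
      𝟙? (_ <? suc t)                                   ≡⟨ adjacent-diagonals D≢t ⟩
      𝟙? (_ <? suc t)                                   ≡⟨ sym (diagonal-hits _ _ D+1<n onD+1 (up u₂)) ⟩
      sumOf (λ x → hits (u₂ Z.+ + x) (+ x)) (upTo n)    ∎
      where open ≡-Reasoning

record DiagonalWindow (n : ℕ) : Set where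
  field
    rf cf : ℕ → ℤ
    key : ℤ → ℤ → ℤ
    line : ℤ
    shape : DiagonalShape n rf cf key line
    sweeps : KeySweeps key

module _ (n : ℕ) where
  open Congruence n

  -- Row a: the cells (a , a - t′) of d_t′(r_a); over it Φ is ΣRow n X a t by definition.
  rowWindow : ℕ → DiagonalWindow n
  rowWindow a = record
    { rf = λ _ → + a ; cf = λ t′ → + a Z.- + t′ ; key = λ r _ → r ; line = + a
    ; shape = shape ; sweeps = (λ u → descending u (λ _ → refl)) , (λ u → ascending u (λ _ → refl)) }
    where
    shape : DiagonalShape n (λ _ → + a) (λ t′ → + a Z.- + t′) (λ r _ → r) (+ a)
    shape r c D t′ onD with ≡mod n r (+ a) in r≡a
    ... | false = refl
    ... | true = trans (≡mod-transfer c (+ a Z.- + t′) (+ t′) (+ D) (≡mod-true⇒∣ r (+ a) r≡a) shift)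
                       (≡mod-sym (+ t′) (+ D))
      where
      regroup : ∀ r c a t → c Z.- (a Z.- t) ≡ (t Z.- (r Z.- c)) Z.+ (r Z.- a)
      regroup = solve-∀
      shift : c Z.- (+ a Z.- + t′) ≡ (+ t′ Z.- + D) Z.+ (r Z.- + a)
      shift = trans (regroup r c (+ a) (+ t′)) (cong (λ d → (+ t′ Z.- d) Z.+ (r Z.- + a)) onD)

  -- Column a: the cells (a + t′ , a) of d_t′(c_a); over it Φ is ΣCol n X a t by definition.
  colWindow : ℕ → DiagonalWindow n
  colWindow a = record
    { rf = λ t′ → + a Z.+ + t′ ; cf = λ _ → + a ; key = λ _ c → c ; line = + a
    ; shape = shape
    ; sweeps = (λ _ → descending (+ 0) (λ x → sym (ZP.+-identityˡ _)))
             , (λ _ → ascending (+ 0) (λ x → sym (ZP.+-identityˡ _))) }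
    where
    shape : DiagonalShape n (λ t′ → + a Z.+ + t′) (λ _ → + a) (λ _ c → c) (+ a)
    shape r c D t′ onD with ≡mod n c (+ a) in c≡a
    ... | false = ∧-zeroʳ _
    ... | true = trans (∧-identityʳ _)
                       (≡mod-transfer r (+ a Z.+ + t′) (+ D) (+ t′) (≡mod-true⇒∣ c (+ a) c≡a) shift)
      where
      regroup : ∀ r c a t → r Z.- (a Z.+ t) ≡ ((r Z.- c) Z.- t) Z.+ (c Z.- a)
      regroup = solve-∀
      shift : r Z.- (+ a Z.+ + t′) ≡ (+ D Z.- + t′) Z.+ (c Z.- + a)
      shift = trans (regroup r c (+ a) (+ t′)) (cong (λ d → (d Z.- + t′) Z.+ (c Z.- + a)) onD)

balanced-shift : {A : Set} (L : List A) (f g h k : A → ℤ) (δ : ℤ) → sumOf h L ≡ sumOf k L →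
  sumOf (λ x → (f x Z.+ δ) Z.* h x Z.+ (g x Z.- δ) Z.* k x) L ≡ sumOf (λ x → f x Z.* h x Z.+ g x Z.* k x) L
balanced-shift L f g h k δ Σh≡Σk = begin
  sumOf (λ x → (f x Z.+ δ) Z.* h x Z.+ (g x Z.- δ) Z.* k x) L
    ≡⟨ sumOf-cong L (λ x → expand (f x) (g x) (h x) (k x) δ) ⟩
  sumOf (λ x → base x Z.+ (δ Z.* h x Z.+ Z.- δ Z.* k x)) L
    ≡⟨ sumOf-+ base _ L ⟩
  sumOf base L Z.+ sumOf (λ x → δ Z.* h x Z.+ Z.- δ Z.* k x) L
    ≡⟨ cong (Z._+_ (sumOf base L)) (trans (sumOf-+ _ _ L) (cong₂ Z._+_ (sumOf-*ˡ δ h L) (sumOf-*ˡ (Z.- δ) k L))) ⟩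
  sumOf base L Z.+ (δ Z.* sumOf h L Z.+ Z.- δ Z.* sumOf k L)
    ≡⟨ cong (λ s → sumOf base L Z.+ (δ Z.* s Z.+ Z.- δ Z.* sumOf k L)) Σh≡Σk ⟩
  sumOf base L Z.+ (δ Z.* sumOf k L Z.+ Z.- δ Z.* sumOf k L)
    ≡⟨ cancel (sumOf base L) δ (sumOf k L) ⟩
  sumOf base L ∎
  where
  open ≡-Reasoning
  base : _ → ℤ
  base x = f x Z.* h x Z.+ g x Z.* k x
  expand : ∀ f g h k δ → (f Z.+ δ) Z.* h Z.+ (g Z.- δ) Z.* k ≡ (f Z.* h Z.+ g Z.* k) Z.+ (δ Z.* h Z.+ Z.- δ Z.* k)
  expand = solve-∀
  cancel : ∀ b δ s → b Z.+ (δ Z.* s Z.+ Z.- δ Z.* s) ≡ b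
  cancel = solve-∀

-- A block places the values a u x and b u x on the cells (r₁ x , c₁ x) and (r₂ x , c₂ x),
-- a label u entering them through opposite shifts ±δ u.
block-invariant : (h : ℤ → ℤ → ℤ) (L : List ℕ) (a b : ℤ → ℕ → ℤ) (r₁ c₁ r₂ c₂ : ℕ → ℤ) (δ : ℤ → ℤ) →
  (∀ u x → a u x ≡ a (+ 0) x Z.+ δ u) → (∀ u x → b u x ≡ b (+ 0) x Z.- δ u) →
  sumOf (λ x → h (r₁ x) (c₁ x)) L ≡ sumOf (λ x → h (r₂ x) (c₂ x)) L →
  ∀ u → weightedSum h (concatMap (λ x → (a u x , r₁ x , c₁ x) ∷ (b u x , r₂ x , c₂ x) ∷ []) L)
      ≡ weightedSum h (concatMap (λ x → (a (+ 0) x , r₁ x , c₁ x) ∷ (b (+ 0) x , r₂ x , c₂ x) ∷ []) L)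
block-invariant h L a b r₁ c₁ r₂ c₂ δ a-shift b-shift balanced u = begin
  weightedSum h (block u)                                             ≡⟨ pairs u ⟩
  sumOf (λ x → a u x Z.* h₁ x Z.+ b u x Z.* h₂ x) L                   ≡⟨ sumOf-cong L shifted ⟩
  sumOf (λ x → (a₀ x Z.+ δ u) Z.* h₁ x Z.+ (b₀ x Z.- δ u) Z.* h₂ x) L ≡⟨ balanced-shift L a₀ b₀ h₁ h₂ (δ u) balanced ⟩
  sumOf (λ x → a₀ x Z.* h₁ x Z.+ b₀ x Z.* h₂ x) L                     ≡⟨ sym (pairs (+ 0)) ⟩
  weightedSum h (block (+ 0))                                         ∎
  where
  open ≡-Reasoning
  h₁ h₂ a₀ b₀ : ℕ → ℤ
  h₁ x = h (r₁ x) (c₁ x)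
  h₂ x = h (r₂ x) (c₂ x)
  a₀ = a (+ 0)
  b₀ = b (+ 0)
  block : ℤ → List Placement
  block u = concatMap (λ x → (a u x , r₁ x , c₁ x) ∷ (b u x , r₂ x , c₂ x) ∷ []) L
  pairs : ∀ u → weightedSum h (block u) ≡ sumOf (λ x → a u x Z.* h₁ x Z.+ b u x Z.* h₂ x) L
  pairs u = trans (sumOf-concatMap (weight h) _ L) (sumOf-cong L (λ x → cong (Z._+_ (a u x Z.* h₁ x)) (ZP.+-identityʳ _)))
  shifted : ∀ x → a u x Z.* h₁ x Z.+ b u x Z.* h₂ x ≡ (a₀ x Z.+ δ u) Z.* h₁ x Z.+ (b₀ x Z.- δ u) Z.* h₂ x
  shifted x = cong₂ (λ v w → v Z.* h₁ x Z.+ w Z.* h₂ x) (a-shift u x) (b-shift u x)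

-- The array A' of Defs, with the labels f_I(i), f_J(j) replaced by arbitrary integers.
module Layout (p γ n α : ℕ) where
  N P G A : ℤ
  N = + n
  P = + p
  G = + γ
  A = + α

  value₁ value₂ value₄ value₅ : ℤ → ℕ → ℤ
  value₁ u x = (G Z.+ + 2) Z.* N Z.+ + 4 Z.* u Z.* N Z.- + 2 Z.* + x
  value₂ u x = Z.- (G Z.* N) Z.- + 4 Z.* u Z.* N Z.- + 1 Z.- + 2 Z.* + x
  value₄ u x = (+ 4 Z.* P Z.+ G Z.- + 6) Z.* N Z.- + 4 Z.* u Z.* N Z.+ + 1 Z.+ + 2 Z.* + x
  value₅ u x = Z.- ((+ 4 Z.* P Z.+ G Z.- + 4) Z.* N) Z.+ + 4 Z.* u Z.* N Z.+ + 2 Z.* + x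

  shift : ℤ → ℤ
  shift u = + 4 Z.* u Z.* N

  value₁-shift : ∀ u x → value₁ u x ≡ value₁ (+ 0) x Z.+ shift u
  value₁-shift u x = ring G N u (+ x)
    where
    ring : ∀ G N u x → (G Z.+ + 2) Z.* N Z.+ + 4 Z.* u Z.* N Z.- + 2 Z.* x
                     ≡ ((G Z.+ + 2) Z.* N Z.+ + 4 Z.* + 0 Z.* N Z.- + 2 Z.* x) Z.+ + 4 Z.* u Z.* N
    ring = solve-∀

  value₂-shift : ∀ u x → value₂ u x ≡ value₂ (+ 0) x Z.- shift u
  value₂-shift u x = ring G N u (+ x)
    where
    ring : ∀ G N u x → Z.- (G Z.* N) Z.- + 4 Z.* u Z.* N Z.- + 1 Z.- + 2 Z.* x
                     ≡ (Z.- (G Z.* N) Z.- + 4 Z.* + 0 Z.* N Z.- + 1 Z.- + 2 Z.* x) Z.- + 4 Z.* u Z.* N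
    ring = solve-∀

  value₄-shift : ∀ u x → value₄ u x ≡ value₄ (+ 0) x Z.+ Z.- shift u
  value₄-shift u x = ring P G N u (+ x)
    where
    ring : ∀ P G N u x → (+ 4 Z.* P Z.+ G Z.- + 6) Z.* N Z.- + 4 Z.* u Z.* N Z.+ + 1 Z.+ + 2 Z.* x
                       ≡ ((+ 4 Z.* P Z.+ G Z.- + 6) Z.* N Z.- + 4 Z.* + 0 Z.* N Z.+ + 1 Z.+ + 2 Z.* x)
                           Z.+ Z.- (+ 4 Z.* u Z.* N)
    ring = solve-∀

  value₅-shift : ∀ u x → value₅ u x ≡ value₅ (+ 0) x Z.- Z.- shift u
  value₅-shift u x = ring P G N u (+ x)
    where
    ring : ∀ P G N u x → Z.- ((+ 4 Z.* P Z.+ G Z.- + 4) Z.* N) Z.+ + 4 Z.* u Z.* N Z.+ + 2 Z.* x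
                       ≡ (Z.- ((+ 4 Z.* P Z.+ G Z.- + 4) Z.* N) Z.+ + 4 Z.* + 0 Z.* N Z.+ + 2 Z.* x)
                           Z.- Z.- (+ 4 Z.* u Z.* N)
    ring = solve-∀

  row₁ row₂ : Fin p → ℕ → ℤ
  row₁ i x = + 2 Z.* + toℕ i Z.- + x
  row₂ i x = + 2 Z.* + toℕ i Z.+ + 1 Z.+ + x
  row₄ row₅ : Fin (p ∸ 1) → ℕ → ℤ
  row₄ j x = + 2 Z.* P Z.+ + 1 Z.+ + 2 Z.* + toℕ j Z.- + x
  row₅ j x = + 2 Z.* P Z.+ + 2 Z.+ + 2 Z.* + toℕ j Z.+ + x
  col₋ col₊ : ℕ → ℤ
  col₋ x = Z.- + x
  col₊ x = + x

  descend : ∀ u x → (u Z.- x) Z.- Z.- x ≡ u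
  descend = solve-∀

  ascend : ∀ u x → (u Z.+ x) Z.- x ≡ u
  ascend = solve-∀

  +-one : ∀ m → + m Z.+ + 1 ≡ + suc m
  +-one m = trans (sym (ZP.pos-+ m 1)) (cong +_ (ℕP.+-comm m 1))

  blockJ-start : ∀ j → + 2 Z.* P Z.+ + 1 Z.+ + 2 Z.* + j ≡ + (2 * p + 1 + 2 * j)
  blockJ-start j = sym (trans (ZP.pos-+ (2 * p + 1) (2 * j))
    (cong₂ Z._+_ (trans (ZP.pos-+ (2 * p) 1) (cong (Z._+ + 1) (ZP.pos-* 2 p))) (ZP.pos-* 2 j)))

  row₁-diagonal : ∀ i x → row₁ i x Z.- col₋ x ≡ + (2 * toℕ i)
  row₁-diagonal i x = trans (descend (+ 2 Z.* + toℕ i) (+ x)) (sym (ZP.pos-* 2 (toℕ i)))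

  row₂-diagonal : ∀ i x → row₂ i x Z.- col₊ x ≡ + suc (2 * toℕ i)
  row₂-diagonal i x = trans (ascend (+ 2 Z.* + toℕ i Z.+ + 1) (+ x))
                            (trans (cong (Z._+ + 1) (sym (ZP.pos-* 2 (toℕ i)))) (+-one (2 * toℕ i)))

  row₄-diagonal : ∀ j x → row₄ j x Z.- col₋ x ≡ + (2 * p + 1 + 2 * toℕ j)
  row₄-diagonal j x = trans (descend (+ 2 Z.* P Z.+ + 1 Z.+ + 2 Z.* + toℕ j) (+ x)) (blockJ-start (toℕ j))

  row₅-diagonal : ∀ j x → row₅ j x Z.- col₊ x ≡ + suc (2 * p + 1 + 2 * toℕ j)
  row₅-diagonal j x = trans (ascend (+ 2 Z.* P Z.+ + 2 Z.+ + 2 Z.* + toℕ j) (+ x))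
    (trans (regroup (+ 2 Z.* P) (+ 2 Z.* + toℕ j))
    (trans (cong (Z._+ + 1) (blockJ-start (toℕ j))) (+-one (2 * p + 1 + 2 * toℕ j))))
    where
    regroup : ∀ a b → a Z.+ + 2 Z.+ b ≡ (a Z.+ + 1 Z.+ b) Z.+ + 1
    regroup = solve-∀

  blockI : ℤ → Fin p → List Placement
  blockI u i = concatMap (λ x → (value₁ u x , row₁ i x , col₋ x) ∷ (value₂ u x , row₂ i x , col₊ x) ∷ []) (upTo n)

  blockJ : ℤ → Fin (p ∸ 1) → List Placement
  blockJ u j = concatMap (λ x → (value₄ u x , row₄ j x , col₋ x) ∷ (value₅ u x , row₅ j x , col₊ x) ∷ []) (upTo n)

  diagonal₃ diagonal₆ : List Placement
  diagonal₃ = map (λ x → (Z.- ((+ 4 Z.* P Z.+ G) Z.* N) Z.+ + 2 Z.* + x) , (+ 2 Z.* P Z.- A Z.* + x) , (Z.- (A Z.* + x))) (upTo n)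
  diagonal₆ = map (λ x → ((+ 4 Z.* P Z.+ G Z.- + 2) Z.* N Z.+ + 1 Z.+ + 2 Z.* + x) , (+ 2 Z.* P Z.+ A Z.+ A Z.* + x) , (A Z.* + x)) (upTo n)

  arrangement : (Fin p → ℤ) → (Fin (p ∸ 1) → ℤ) → List Placement
  arrangement FI FJ = concatMap (λ i → blockI (FI i) i) (allFin p) ++ diagonal₃
                   ++ concatMap (λ j → blockJ (FJ j) j) (allFin (p ∸ 1)) ++ diagonal₆

  labels : ∀ {m} → Permutation′ m → Fin m → ℤ
  labels f i = + toℕ (f ⟨$⟩ʳ i)

  arrayA'-arrangement : (fI : Permutation′ p) (fJ : Permutation′ (p ∸ 1)) →
    arrayA' p γ n α fI fJ ≡ arrangement (labels fI) (labels fJ)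
  arrayA'-arrangement fI fJ = refl

  relabel-invariant : (h : ℤ → ℤ → ℤ) →
    (∀ i → sumOf (λ x → h (row₁ i x) (col₋ x)) (upTo n) ≡ sumOf (λ x → h (row₂ i x) (col₊ x)) (upTo n)) →
    (∀ j → sumOf (λ x → h (row₄ j x) (col₋ x)) (upTo n) ≡ sumOf (λ x → h (row₅ j x) (col₊ x)) (upTo n)) →
    ∀ FI FJ FI′ FJ′ → weightedSum h (arrangement FI FJ) ≡ weightedSum h (arrangement FI′ FJ′)
  relabel-invariant h balancedI balancedJ FI FJ FI′ FJ′ = begin
    W (arrangement FI FJ)                               ≡⟨ split FI FJ ⟩
    sumI FI Z.+ (W diagonal₃ Z.+ (sumJ FJ Z.+ W diagonal₆))
      ≡⟨ cong₂ (λ s s′ → s Z.+ (W diagonal₃ Z.+ (s′ Z.+ W diagonal₆)))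
               (sumOf-cong (allFin p) relabelI) (sumOf-cong (allFin (p ∸ 1)) relabelJ) ⟩
    sumI FI′ Z.+ (W diagonal₃ Z.+ (sumJ FJ′ Z.+ W diagonal₆)) ≡⟨ sym (split FI′ FJ′) ⟩
    W (arrangement FI′ FJ′)                             ∎
    where
    open ≡-Reasoning
    W : List Placement → ℤ
    W = weightedSum h
    sumI : (Fin p → ℤ) → ℤ
    sumI FI = sumOf (λ i → W (blockI (FI i) i)) (allFin p)
    sumJ : (Fin (p ∸ 1) → ℤ) → ℤ
    sumJ FJ = sumOf (λ j → W (blockJ (FJ j) j)) (allFin (p ∸ 1))
    split : ∀ FI FJ → W (arrangement FI FJ) ≡ sumI FI Z.+ (W diagonal₃ Z.+ (sumJ FJ Z.+ W diagonal₆))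
    split FI FJ =
      trans (sumOf-++ (weight h) (concatMap _ (allFin p)) _)
      (cong₂ Z._+_ (sumOf-concatMap (weight h) _ (allFin p))
      (trans (sumOf-++ (weight h) diagonal₃ _)
      (cong (Z._+_ (W diagonal₃))
      (trans (sumOf-++ (weight h) (concatMap _ (allFin (p ∸ 1))) diagonal₆)
      (cong (Z._+ W diagonal₆) (sumOf-concatMap (weight h) _ (allFin (p ∸ 1))))))))
    invariantI : ∀ i u → W (blockI u i) ≡ W (blockI (+ 0) i)
    invariantI i = block-invariant h (upTo n) value₁ value₂ (row₁ i) col₋ (row₂ i) col₊ shift
                     value₁-shift value₂-shift (balancedI i)
    invariantJ : ∀ j u → W (blockJ u j) ≡ W (blockJ (+ 0) j)
    invariantJ j = block-invariant h (upTo n) value₄ value₅ (row₄ j) col₋ (row₅ j) col₊ (λ u → Z.- shift u)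
                     value₄-shift value₅-shift (balancedJ j)
    relabelI : ∀ i → W (blockI (FI i) i) ≡ W (blockI (FI′ i) i)
    relabelI i = trans (invariantI i (FI i)) (sym (invariantI i (FI′ i)))
    relabelJ : ∀ j → W (blockJ (FJ j) j) ≡ W (blockJ (FJ′ j) j)
    relabelJ j = trans (invariantJ j (FJ j)) (sym (invariantJ j (FJ′ j)))

-- The step t of a prefix sum is admissible for p and n if it lies inside the array and is
-- none of the diagonals 2i (i < p) or 2p+1+2j (j+1 < p): the prefix then contains both
-- diagonals of every block or neither.
record Admissible (p n t : ℕ) : Set where
  field
    t<n : t < n
    avoids-I : ∀ {i} → i < p → 2 * i ≢ t
    avoids-J : ∀ {j} → suc j < p → 2 * p + 1 + 2 * j ≢ t

module Identities where
  twice-suc : ∀ i → suc (suc (2 * i)) ≡ 2 * suc i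
  twice-suc = solveℕ-∀
  double-2p : ∀ p → 2 * p + 2 * p ≡ 4 * p
  double-2p = solveℕ-∀
  blockJ-top : ∀ p j → suc (suc (2 * p + 1 + 2 * j)) ≡ 2 * p + suc (2 * suc j)
  blockJ-top = solveℕ-∀
  blockJ-odd : ∀ p j → 2 * p + 1 + 2 * j ≡ suc (2 * (p + j))
  blockJ-odd = solveℕ-∀
  blockJ-even : ∀ p j → 2 * p + 2 * j + 2 ≡ 2 * (p + j + 1)
  blockJ-even = solveℕ-∀
  blockJ-step : ∀ p j → suc (2 * p + 1 + 2 * j) ≡ 2 * p + 2 * j + 2
  blockJ-step = solveℕ-∀
  past-α : ∀ p α → suc (2 * p + α) ≡ α + suc (2 * p)
  past-α = solveℕ-∀

J-index< : ∀ p (j : Fin (p ∸ 1)) → suc (toℕ j) < p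
J-index< (suc _) j = s≤s (FinP.toℕ<n j)

module Diagonals {p n : ℕ} (4p≤n : 4 * p ≤ n) where
  open Identities
  open ℕP.≤-Reasoning

  double-< : ∀ {i} → i < p → suc (2 * i) < 2 * p
  double-< {i} i<p = begin
    suc (suc (2 * i)) ≡⟨ twice-suc i ⟩
    2 * suc i         ≤⟨ ℕP.*-monoʳ-≤ 2 i<p ⟩
    2 * p             ∎

  below-2p : ∀ {i} → i < p → 2 * i < 2 * p
  below-2p i<p = ℕP.<-trans (ℕP.n<1+n _) (double-< i<p)

  above-2p : ∀ j → 2 * p < 2 * p + 1 + 2 * j
  above-2p j = ℕP.<-≤-trans (ℕP.m<m+n (2 * p) (s≤s z≤n)) (ℕP.m≤m+n (2 * p + 1) (2 * j))

  2p≤n : 2 * p ≤ n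
  2p≤n = ℕP.≤-trans (ℕP.*-monoˡ-≤ p {2} {4} (s≤s (s≤s z≤n))) 4p≤n

  2p<n : 0 < p → 2 * p < n
  2p<n 0<p = begin-strict
    2 * p         <⟨ ℕP.m<m+n (2 * p) (ℕP.*-monoʳ-< 2 0<p) ⟩
    2 * p + 2 * p ≡⟨ double-2p p ⟩
    4 * p         ≤⟨ 4p≤n ⟩
    n             ∎

  I-diagonal< : ∀ {i} → i < p → suc (2 * i) < n
  I-diagonal< i<p = ℕP.<-≤-trans (double-< i<p) 2p≤n

  J-diagonal< : ∀ {j} → suc j < p → suc (2 * p + 1 + 2 * j) < n
  J-diagonal< {j} j+1<p = begin
    suc (suc (2 * p + 1 + 2 * j)) ≡⟨ blockJ-top p j ⟩
    2 * p + suc (2 * suc j)       ≤⟨ ℕP.+-monoʳ-≤ (2 * p) (ℕP.<⇒≤ (double-< j+1<p)) ⟩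
    2 * p + 2 * p                 ≡⟨ double-2p p ⟩
    4 * p                         ≤⟨ 4p≤n ⟩
    n                             ∎

  admissible-I : ∀ {i} → i < p → Admissible p n (2 * i + 1)
  admissible-I {i} i<p = record
    { t<n = subst (_< n) (ℕP.+-comm 1 (2 * i)) (I-diagonal< i<p)
    ; avoids-I = λ {i′} _ eq → ℕP.even≢odd i′ i (trans eq (ℕP.+-comm (2 * i) 1))
    ; avoids-J = λ {j} _ → ℕP.>⇒≢ (begin-strict
        2 * i + 1          ≡⟨ ℕP.+-comm (2 * i) 1 ⟩
        suc (2 * i)        <⟨ double-< i<p ⟩
        2 * p              <⟨ above-2p j ⟩
        2 * p + 1 + 2 * j  ∎)
    }

  admissible-J : ∀ {j} → suc j < p → Admissible p n (2 * p + 2 * j + 2)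
  admissible-J {j} j+1<p = record
    { t<n = subst (_< n) (blockJ-step p j) (J-diagonal< j+1<p)
    ; avoids-I = λ i<p → ℕP.<⇒≢ (ℕP.<-≤-trans (below-2p i<p)
                                   (ℕP.≤-trans (ℕP.m≤m+n (2 * p) (2 * j)) (ℕP.m≤m+n (2 * p + 2 * j) 2)))
    ; avoids-J = λ {j′} _ eq → ℕP.even≢odd (p + j + 1) (p + j′)
                                  (sym (trans (sym (blockJ-odd p j′)) (trans eq (blockJ-even p j))))
    }

  admissible-2p : 0 < p → Admissible p n (2 * p)
  admissible-2p 0<p = record
    { t<n = 2p<n 0<p
    ; avoids-I = λ i<p → ℕP.<⇒≢ (below-2p i<p)
    ; avoids-J = λ {j} _ → ℕP.>⇒≢ (above-2p j)
    }

  admissible-α : ∀ {α} → 0 < p → 2 * p ∸ 1 ≤ α → α ≤ n ∸ 2 * p ∸ 1 → Admissible p n (2 * p + α)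
  admissible-α {α} 0<p α≥ α≤ = record
    { t<n = begin
        suc (2 * p + α)                 ≡⟨ past-α p α ⟩
        α + suc (2 * p)                 ≤⟨ ℕP.+-monoˡ-≤ (suc (2 * p)) α≤′ ⟩
        (n ∸ suc (2 * p)) + suc (2 * p) ≡⟨ ℕP.m∸n+n≡m (2p<n 0<p) ⟩
        n                               ∎
    ; avoids-I = λ i<p → ℕP.<⇒≢ (ℕP.<-≤-trans (below-2p i<p) (ℕP.m≤m+n (2 * p) α))
    ; avoids-J = λ {j} j+1<p → ℕP.<⇒≢ (begin-strict
        2 * p + 1 + 2 * j   ≡⟨ ℕP.+-assoc (2 * p) 1 (2 * j) ⟩
        2 * p + suc (2 * j) <⟨ ℕP.+-monoʳ-< (2 * p) (1+2j<α j+1<p) ⟩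
        2 * p + α           ∎)
    }
    where
    α≤′ : α ≤ n ∸ suc (2 * p)
    α≤′ = subst (α ≤_) (trans (ℕP.∸-+-assoc n (2 * p) 1) (cong (n ∸_) (ℕP.+-comm (2 * p) 1))) α≤
    1+2j<α : ∀ {j} → suc j < p → suc (2 * j) < α
    1+2j<α {j} j+1<p = begin
      suc (suc (2 * j)) ≡⟨ twice-suc j ⟩
      2 * suc j         ≤⟨ ℕP.n≤1+n _ ⟩
      suc (2 * suc j)   ≤⟨ ℕP.∸-monoˡ-≤ 1 (double-< j+1<p) ⟩
      2 * p ∸ 1         ≤⟨ α≥ ⟩
      α                 ∎

  admissible : ∀ {α t} → 0 < p → 2 * p ∸ 1 ≤ α → α ≤ n ∸ 2 * p ∸ 1 → (i : Fin p) (j : Fin (p ∸ 1)) →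
    (t ≡ 2 * toℕ i + 1 ⊎ t ≡ 2 * p + 2 * toℕ j + 2 ⊎ t ≡ 2 * p ⊎ t ≡ 2 * p + α) → Admissible p n t
  admissible _ _ _ i j (inj₁ refl) = admissible-I (FinP.toℕ<n i)
  admissible _ _ _ i j (inj₂ (inj₁ refl)) = admissible-J (J-index< p j)
  admissible 0<p _ _ i j (inj₂ (inj₂ (inj₁ refl))) = admissible-2p 0<p
  admissible 0<p α≥ α≤ i j (inj₂ (inj₂ (inj₂ refl))) = admissible-α 0<p α≥ α≤

window-invariant : ∀ {p γ n α t} .{{_ : NonZero n}} → 4 * p ≤ n → Admissible p n t → (W : DiagonalWindow n) →
  (fI fI′ : Permutation′ p) (fJ fJ′ : Permutation′ (p ∸ 1)) →
  Window.Φ n t (DiagonalWindow.rf W) (DiagonalWindow.cf W) (arrayA' p γ n α fI fJ)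
    ≡ Window.Φ n t (DiagonalWindow.rf W) (DiagonalWindow.cf W) (arrayA' p γ n α fI′ fJ′)
window-invariant {p} {γ} {n} {α} {t} 4p≤n adm W fI fI′ fJ fJ′ = begin
  Φ (arrayA' p γ n α fI fJ)                                ≡⟨ cong Φ (arrayA'-arrangement fI fJ) ⟩
  Φ (arrangement (labels fI) (labels fJ))                  ≡⟨ Φ-weighted (arrangement (labels fI) (labels fJ)) ⟩
  weightedSum hits (arrangement (labels fI) (labels fJ))
    ≡⟨ relabel-invariant hits balancedI balancedJ (labels fI) (labels fJ) (labels fI′) (labels fJ′) ⟩
  weightedSum hits (arrangement (labels fI′) (labels fJ′)) ≡⟨ sym (Φ-weighted (arrangement (labels fI′) (labels fJ′))) ⟩
  Φ (arrangement (labels fI′) (labels fJ′))                ≡⟨ sym (cong Φ (arrayA'-arrangement fI′ fJ′)) ⟩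
  Φ (arrayA' p γ n α fI′ fJ′)                              ∎
  where
  open ≡-Reasoning
  open DiagonalWindow W
  open Window n t rf cf
  open Layout p γ n α
  open Diagonals {p} {n} 4p≤n
  open Admissible adm
  balancedI : ∀ i → sumOf (λ x → hits (row₁ i x) (col₋ x)) (upTo n) ≡ sumOf (λ x → hits (row₂ i x) (col₊ x)) (upTo n)
  balancedI i = adjacent-balanced {key} {line} shape t<n sweeps (+ 2 Z.* + toℕ i) (+ 2 Z.* + toℕ i Z.+ + 1)
                  (I-diagonal< i<p) (avoids-I i<p) (row₁-diagonal i) (row₂-diagonal i)
    where i<p = FinP.toℕ<n i
  balancedJ : ∀ j → sumOf (λ x → hits (row₄ j x) (col₋ x)) (upTo n) ≡ sumOf (λ x → hits (row₅ j x) (col₊ x)) (upTo n)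
  balancedJ j = adjacent-balanced {key} {line} shape t<n sweeps (+ 2 Z.* P Z.+ + 1 Z.+ + 2 Z.* + toℕ j) (+ 2 Z.* P Z.+ + 2 Z.+ + 2 Z.* + toℕ j)
                  (J-diagonal< j+1<p) (avoids-J j+1<p) (row₄-diagonal j) (row₅-diagonal j)
    where j+1<p = J-index< p j

mainTheorem12 : (p γ n α : ℕ) → 0 < p → 0 < γ → 4 * p ≤ n →
    2 * p ∸ 1 ≤ α → α ≤ n ∸ 2 * p ∸ 1 → gcd α n ≡ 1 →
    (fI : Permutation′ p) (fJ : Permutation′ (p ∸ 1)) →
    (a : ℕ) → a < n → (i : Fin p) (j : Fin (p ∸ 1)) (t : ℕ) →
    (t ≡ 2 * toℕ i + 1 ⊎ t ≡ 2 * p + 2 * toℕ j + 2 ⊎ t ≡ 2 * p ⊎ t ≡ 2 * p + α) →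
    (ΣRow n (arrayA' p γ n α fI fJ) a t ≡ ΣRow n (arrayA p γ n α) a t)
    × (ΣCol n (arrayA' p γ n α fI fJ) a t ≡ ΣCol n (arrayA p γ n α) a t)
mainTheorem12 p γ n α 0<p _ 4p≤n α≥ α≤ _ fI fJ a _ i j t t-cases =
    window-invariant 4p≤n adm (rowWindow n a) fI Perm.id fJ Perm.id
  , window-invariant 4p≤n adm (colWindow n a) fI Perm.id fJ Perm.id
  where
  instance
    n≢0 : NonZero n
    n≢0 = >-nonZero (ℕP.<-≤-trans (ℕP.*-monoʳ-< 4 0<p) 4p≤n)
  adm : Admissible p n t
  adm = Diagonals.admissible {p} {n} 4p≤n 0<p α≥ α≤ i j t-cases
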